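{- Let $f, g \in \mathbb{Z}[X]$ be nonconstant monic polynomials with $f \mid g$, let $m$ be a positive integer, and let $p$ be a prime number. Suppose that there exists $a \in \mathbb{Z}$ with $p \nmid a$ such that $p \mid f(a)$ and the multiplicative order of $a$ modulo $p$ equals $m$. Then $m \in \mathfrak{M}(g)$.
   Context: For a nonconstant monic polynomial $g(X) = X^r - c_1X^{r-1} - c_2X^{r-2} - \cdots - c_r \in \mathbb{Z}[X]$, an integer linear recurrence with characteristic polynomial $g$ is an integer sequence $(s_n)_{n\ge 0}$ with $s_n = c_1 s_{n-1} + \cdots + c_r s_{n-r}$ for all $n \ge r$ (the initial conditions $s_0,\dots,s_{r-1}\in\mathbb{Z}$ are arbitrary). $\mathfrak{M}(g)$ denotes the set of positive integers $m$ for which there exist integer initial conditions $s_0,\dots,s_{r-1}$ and a positive integer $M$ such that the resulting linear recurrence $(s_n)_{n\ge0}$ with characteristic polynomial $g$ takes exactly $m$ distinct residues modulo $M$. -}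

module Defs where

open import Data.Nat as ℕ using (ℕ; zero; suc; _≤_; _<_; _∸_; NonZero)
open import Data.Nat.Primality using (Prime)
open import Data.Integer as ℤ using (ℤ; +_; _%ℕ_; _^_)
open import Data.Integer.Divisibility using (_∣_)
open import Data.Fin using (Fin; toℕ) renaming (zero to fz; suc to fs)
open import Data.List using (List; []; _∷_; map; reverse; tabulate)
open import Data.Product using (Σ; ∃; _×_)
open import Function.Definitions using (Injective)
open import Relation.Binary.PropositionalEquality using (_≡_)
open import Relation.Nullary using (¬_)

-- Polynomials in ℤ[X] as coefficient lists, lowest degree first
-- (trailing zeros allowed; equality is coefficientwise via `coeff`).
Poly : Set
Poly = List ℤ

coeff : Poly → ℕ → ℤ
coeff []       _       = + 0
coeff (x ∷ p)  zero    = x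
coeff (x ∷ p)  (suc k) = coeff p k

addP : Poly → Poly → Poly
addP []       q        = q
addP p        []       = p
addP (x ∷ p)  (y ∷ q)  = (x ℤ.+ y) ∷ addP p q

mulP : Poly → Poly → Poly
mulP []       q = []
mulP (x ∷ p)  q = addP (map (x ℤ.*_) q) (+ 0 ∷ mulP p q)

eval : Poly → ℤ → ℤ
eval []       a = + 0
eval (x ∷ p)  a = x ℤ.+ a ℤ.* eval p a

_∣ₚ_ : Poly → Poly → Set
f ∣ₚ g = Σ Poly λ h → ∀ k → coeff (mulP f h) k ≡ coeff g k

-- The monic polynomial X^r - c₁X^{r-1} - ... - c_r, where  c i  is c_{i+1}
-- (i : Fin r).  Coefficient list, lowest degree first.
monic : (r : ℕ) → (Fin r → ℤ) → Poly
monic r c = reverse (+ 1 ∷ tabulate (λ i → ℤ.- c i))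

sumFin : (r : ℕ) → (Fin r → ℤ) → ℤ
sumFin zero    f = + 0
sumFin (suc r) f = f fz ℤ.+ sumFin r (λ i → f (fs i))

IsLinRec : (r : ℕ) → (Fin r → ℤ) → (ℕ → ℤ) → Set
IsLinRec r c s = ∀ n → r ≤ n →
  s n ≡ sumFin r (λ i → c i ℤ.* s (n ∸ suc (toℕ i)))

TakesExactlyResidues : (s : ℕ → ℤ) (M : ℕ) .{{_ : NonZero M}} (m : ℕ) → Set
TakesExactlyResidues s M m =
  Σ (Fin m → ℕ) λ v → Injective _≡_ _≡_ v
    × (∀ j → ∃ λ n → v j ≡ (s n %ℕ M))
    × (∀ n → ∃ λ j → v j ≡ (s n %ℕ M))

-- 𝔐(g) for g = X^r - c₁X^{r-1} - ... - c_r
InM : (r : ℕ) → (Fin r → ℤ) → ℕ → Set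
InM r c m = Σ (ℕ → ℤ) λ s → IsLinRec r c s ×
  Σ ℕ λ M → Σ (NonZero M) λ nz → TakesExactlyResidues s M {{nz}} m

MultOrder : ℤ → ℕ → ℕ → Set
MultOrder a p m = 0 < m × (+ p ∣ (a ^ m ℤ.- + 1))
  × (∀ k → 0 < k → + p ∣ (a ^ k ℤ.- + 1) → m ≤ k)

{-# OPTIONS --safe #-}
-- Since f ∣ g and p ∣ f(a), also p ∣ g(a), so the powers a^n satisfy the recurrence of g modulo p.
-- The integer recurrence with initial values 1, a, …, a^(r-1) is therefore congruent to a^n modulo p
-- for every n, and so takes the same residues modulo p as the powers of a: as a has order m, these are
-- the m distinct classes of 1, a, …, a^(m-1).
module Submission where

open import Defs

open import Data.Fin as Fin using (Fin; toℕ) renaming (zero to fz; suc to fs)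
import Data.Fin.Properties as FinP
open import Data.Integer as ℤ using (ℤ; +_; _+_; _*_; -_; _-_; _^_; _%ℕ_; _/ℕ_)
open import Data.Integer.Divisibility using (_∣_)
open import Data.Integer.Divisibility.Signed as Signed using () renaming (_∣_ to _∣ˢ_)
import Data.Integer.DivMod as ℤDivMod
import Data.Integer.Properties as ℤP
open import Data.Integer.Tactic.RingSolver using (solve-∀)
open import Data.List using ([]; _∷_; _++_; [_]; length; map; reverse; tabulate)
import Data.List.Properties as ListP
open import Data.Nat as ℕ using (ℕ; zero; suc; _<_; _≤_; _∸_; s≤s; NonZero)
import Data.Nat.Divisibility as ℕDiv
import Data.Nat.DivMod as ℕDivMod
open import Data.Nat.Induction using (<-rec)
open import Data.Nat.Primality using (Prime; euclidsLemma; ¬prime[1]; prime⇒nonZero)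
import Data.Nat.Properties as ℕP
open import Data.Product as Product using (Σ; ∃; _×_; _,_; proj₁; proj₂)
open import Data.Sum using (_⊎_; [_,_]′)
open import Function using (_∘_)
open import Level using (0ℓ)
open import Relation.Binary.Bundles using (Setoid)
open import Relation.Binary.Definitions using (tri<; tri≈; tri>)
open import Relation.Binary.PropositionalEquality
  using (_≡_; refl; sym; trans; cong; cong₂; subst; module ≡-Reasoning)
import Relation.Binary.Reasoning.Setoid as ≈-Reasoning
open import Relation.Nullary using (¬_; contradiction; yes; no)

sumFin-cong : ∀ r {f g : Fin r → ℤ} → (∀ i → f i ≡ g i) → sumFin r f ≡ sumFin r g
sumFin-cong zero    f≡g = refl
sumFin-cong (suc r) f≡g = cong₂ _+_ (f≡g fz) (sumFin-cong r (f≡g ∘ fs))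

sumFin-distribˡ : ∀ r k (f : Fin r → ℤ) → k * sumFin r f ≡ sumFin r (λ i → k * f i)
sumFin-distribˡ zero    k f = ℤP.*-zeroʳ k
sumFin-distribˡ (suc r) k f =
  trans (ℤP.*-distribˡ-+ k (f fz) _) (cong (_+_ (k * f fz)) (sumFin-distribˡ r k (λ i → f (fs i))))

sumFin-neg : ∀ r (f : Fin r → ℤ) → sumFin r (λ i → - f i) ≡ - sumFin r f
sumFin-neg zero    f = refl
sumFin-neg (suc r) f =
  trans (cong (_+_ (- f fz)) (sumFin-neg r (λ i → f (fs i)))) (sym (ℤP.neg-distrib-+ (f fz) _))

module _ (a : ℤ) where

  private
    eval-[]≡eval-[0] : eval [] a ≡ eval (+ 0 ∷ []) a
    eval-[]≡eval-[0] = sym (trans (ℤP.+-identityˡ _) (ℤP.*-zeroʳ a))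

  eval-cong : ∀ p q → (∀ k → coeff p k ≡ coeff q k) → eval p a ≡ eval q a
  eval-cong []      []      p≗q = refl
  eval-cong []      (y ∷ q) p≗q = trans eval-[]≡eval-[0] (cong₂ (λ u v → u + a * v) (p≗q 0) (eval-cong [] q (p≗q ∘ suc)))
  eval-cong (x ∷ p) []      p≗q = trans (cong₂ (λ u v → u + a * v) (p≗q 0) (eval-cong p [] (p≗q ∘ suc))) (sym eval-[]≡eval-[0])
  eval-cong (x ∷ p) (y ∷ q) p≗q = cong₂ (λ u v → u + a * v) (p≗q 0) (eval-cong p q (p≗q ∘ suc))

  eval-addP : ∀ p q → eval (addP p q) a ≡ eval p a + eval q a
  eval-addP []      q       = sym (ℤP.+-identityˡ _)
  eval-addP (x ∷ p) []      = sym (ℤP.+-identityʳ _)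
  eval-addP (x ∷ p) (y ∷ q) = trans (cong (λ t → x + y + a * t) (eval-addP p q)) (regroup x y a (eval p a) (eval q a))
    where
    regroup : ∀ x y a u v → x + y + a * (u + v) ≡ (x + a * u) + (y + a * v)
    regroup = solve-∀

  eval-scale : ∀ k q → eval (map (k *_) q) a ≡ k * eval q a
  eval-scale k []      = sym (ℤP.*-zeroʳ k)
  eval-scale k (y ∷ q) = trans (cong (λ t → k * y + a * t) (eval-scale k q)) (factor k y a (eval q a))
    where
    factor : ∀ k y a u → k * y + a * (k * u) ≡ k * (y + a * u)
    factor = solve-∀

  eval-mulP : ∀ p q → eval (mulP p q) a ≡ eval p a * eval q a
  eval-mulP []      q = sym (ℤP.*-zeroˡ (eval q a))
  eval-mulP (x ∷ p) q = begin
    eval (addP (map (x *_) q) (+ 0 ∷ mulP p q)) a         ≡⟨ eval-addP (map (x *_) q) _ ⟩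
    eval (map (x *_) q) a + (+ 0 + a * eval (mulP p q) a) ≡⟨ cong₂ (λ u v → u + (+ 0 + a * v)) (eval-scale x q) (eval-mulP p q) ⟩
    x * eval q a + (+ 0 + a * (eval p a * eval q a))     ≡⟨ factor x a (eval p a) (eval q a) ⟩
    (x + a * eval p a) * eval q a                         ∎
    where
    open ≡-Reasoning
    factor : ∀ x a u v → x * v + (+ 0 + a * (u * v)) ≡ (x + a * u) * v
    factor = solve-∀

  eval-∣ₚ : ∀ {f g} → f ∣ₚ g → eval f a ∣ˢ eval g a
  eval-∣ₚ {f} {g} (h , fh≗g) = Signed.divides (eval h a) (begin
    eval g a            ≡⟨ eval-cong g (mulP f h) (sym ∘ fh≗g) ⟩
    eval (mulP f h) a   ≡⟨ eval-mulP f h ⟩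
    eval f a * eval h a ≡⟨ ℤP.*-comm (eval f a) (eval h a) ⟩
    eval h a * eval f a ∎)
    where open ≡-Reasoning

  eval-++ : ∀ xs ys → eval (xs ++ ys) a ≡ eval xs a + a ^ length xs * eval ys a
  eval-++ []       ys = sym (trans (ℤP.+-identityˡ _) (ℤP.*-identityˡ _))
  eval-++ (x ∷ xs) ys = trans (cong (λ t → x + a * t) (eval-++ xs ys)) (regroup x a (eval xs a) (a ^ length xs) (eval ys a))
    where
    regroup : ∀ x a u t v → x + a * (u + t * v) ≡ (x + a * u) + a * t * v
    regroup = solve-∀

  eval-reverse-tabulate : ∀ r (h : Fin r → ℤ) →
    eval (reverse (tabulate h)) a ≡ sumFin r (λ i → a ^ (r ∸ suc (toℕ i)) * h i)
  eval-reverse-tabulate zero    h = refl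
  eval-reverse-tabulate (suc r) h = begin
    eval (reverse (h fz ∷ tabulate (h ∘ fs))) a
      ≡⟨ cong (λ xs → eval xs a) (ListP.unfold-reverse (h fz) (tabulate (h ∘ fs))) ⟩
    eval (reverse (tabulate (h ∘ fs)) ++ [ h fz ]) a
      ≡⟨ eval-++ (reverse (tabulate (h ∘ fs))) [ h fz ] ⟩
    eval (reverse (tabulate (h ∘ fs))) a + a ^ length (reverse (tabulate (h ∘ fs))) * eval [ h fz ] a
      ≡⟨ cong₂ (λ u n → u + a ^ n * eval [ h fz ] a) (eval-reverse-tabulate r (h ∘ fs)) length≡r ⟩
    rest + a ^ r * (h fz + a * + 0)
      ≡⟨ swap rest (a ^ r) (h fz) a ⟩
    a ^ r * h fz + rest ∎
    where
    open ≡-Reasoning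
    rest : ℤ
    rest = sumFin r (λ i → a ^ (r ∸ suc (toℕ i)) * h (fs i))
    length≡r : length (reverse (tabulate (h ∘ fs))) ≡ r
    length≡r = trans (ListP.length-reverse (tabulate (h ∘ fs))) (ListP.length-tabulate (h ∘ fs))
    swap : ∀ u t x a → u + t * (x + a * + 0) ≡ t * x + u
    swap = solve-∀

  eval-monic : ∀ r (c : Fin r → ℤ) →
    eval (monic r c) a ≡ a ^ r - sumFin r (λ i → c i * a ^ (r ∸ suc (toℕ i)))
  eval-monic r c = begin
    eval (reverse (+ 1 ∷ tabulate (-_ ∘ c))) a
      ≡⟨ eval-reverse-tabulate (suc r) (λ { fz → + 1 ; (fs i) → - c i }) ⟩
    a ^ r * + 1 + sumFin r (λ i → a ^ (r ∸ suc (toℕ i)) * - c i)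
      ≡⟨ cong₂ _+_ (ℤP.*-identityʳ (a ^ r)) (sumFin-cong r (λ i → sym (ℤP.neg-distribʳ-* (a ^ (r ∸ suc (toℕ i))) (c i)))) ⟩
    a ^ r + sumFin r (λ i → - (a ^ (r ∸ suc (toℕ i)) * c i))
      ≡⟨ cong (_+_ (a ^ r)) (trans (sumFin-neg r _) (cong -_ (sumFin-cong r (λ i → ℤP.*-comm _ (c i))))) ⟩
    a ^ r - sumFin r (λ i → c i * a ^ (r ∸ suc (toℕ i))) ∎
    where open ≡-Reasoning

module Modulo (n : ℕ) where

  -- A record rather than a synonym for divisibility, so that x and y can be inferred from a proof of x ≈ y.
  infix 4 _≈_
  record _≈_ (x y : ℤ) : Set where
    constructor mod∣
    field ∣-diff : + n ∣ˢ x - y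
  open _≈_ public

  ∣⇒≈ : ∀ {d x y} → d ≡ x - y → + n ∣ˢ d → x ≈ y
  ∣⇒≈ d≡x-y n∣d = mod∣ (subst (+ n ∣ˢ_) d≡x-y n∣d)

  ≈-reflexive : ∀ {x y} → x ≡ y → x ≈ y
  ≈-reflexive {x} refl = ∣⇒≈ (sym (ℤP.+-inverseʳ x)) (Signed.divides (+ 0) refl)

  ≈-refl : ∀ {x} → x ≈ x
  ≈-refl = ≈-reflexive refl

  ≈-sym : ∀ {x y} → x ≈ y → y ≈ x
  ≈-sym {x} {y} (mod∣ n∣x-y) = ∣⇒≈ (negate x y) (Signed.∣m⇒∣-m n∣x-y)
    where
    negate : ∀ x y → - (x - y) ≡ y - x
    negate = solve-∀

  ≈-trans : ∀ {x y z} → x ≈ y → y ≈ z → x ≈ z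
  ≈-trans {x} {y} {z} (mod∣ n∣x-y) (mod∣ n∣y-z) = ∣⇒≈ (telescope x y z) (Signed.∣m∣n⇒∣m+n n∣x-y n∣y-z)
    where
    telescope : ∀ x y z → (x - y) + (y - z) ≡ x - z
    telescope = solve-∀

  setoid : Setoid 0ℓ 0ℓ
  setoid = record
    { Carrier = ℤ
    ; _≈_ = _≈_
    ; isEquivalence = record { refl = ≈-refl ; sym = ≈-sym ; trans = ≈-trans }
    }

  +-cong : ∀ {x y u v} → x ≈ y → u ≈ v → x + u ≈ y + v
  +-cong {x} {y} {u} {v} (mod∣ n∣x-y) (mod∣ n∣u-v) = ∣⇒≈ (regroup x y u v) (Signed.∣m∣n⇒∣m+n n∣x-y n∣u-v)
    where
    regroup : ∀ x y u v → (x - y) + (u - v) ≡ (x + u) - (y + v)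
    regroup = solve-∀

  *-cong : ∀ {x y u v} → x ≈ y → u ≈ v → x * u ≈ y * v
  *-cong {x} {y} {u} {v} (mod∣ n∣x-y) (mod∣ n∣u-v) =
    ∣⇒≈ (regroup x y u v) (Signed.∣m∣n⇒∣m+n (Signed.∣m⇒∣m*n u n∣x-y) (Signed.∣n⇒∣m*n y n∣u-v))
    where
    regroup : ∀ x y u v → (x - y) * u + y * (u - v) ≡ x * u - y * v
    regroup = solve-∀

  ^-cong : ∀ {x y} k → x ≈ y → x ^ k ≈ y ^ k
  ^-cong zero    x≈y = ≈-refl
  ^-cong (suc k) x≈y = *-cong x≈y (^-cong k x≈y)

  sumFin-cong-≈ : ∀ r {f g : Fin r → ℤ} → (∀ i → f i ≈ g i) → sumFin r f ≈ sumFin r g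
  sumFin-cong-≈ zero    f≈g = ≈-refl
  sumFin-cong-≈ (suc r) f≈g = +-cong (f≈g fz) (sumFin-cong-≈ r (f≈g ∘ fs))

  ≈-%ℕ : .{{_ : NonZero n}} → ∀ x → x ≈ + (x %ℕ n)
  ≈-%ℕ x = mod∣ (Signed.divides (x /ℕ n) (begin
    x - + (x %ℕ n)                         ≡⟨ cong (_- + (x %ℕ n)) (ℤDivMod.a≡a%ℕn+[a/ℕn]*n x n) ⟩
    + (x %ℕ n) + x /ℕ n * + n - + (x %ℕ n) ≡⟨ cancel (+ (x %ℕ n)) (x /ℕ n * + n) ⟩
    x /ℕ n * + n                           ∎))
    where
    open ≡-Reasoning
    cancel : ∀ r t → r + t - r ≡ t
    cancel = solve-∀

  ≈-below⇒≡ : ∀ {i j} → i < n → j < n → + i ≈ + j → i ≡ j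
  ≈-below⇒≡ {i} {j} i<n j<n (mod∣ n∣i-j) with ℤ.∣ + i - + j ∣ in eq | Signed.∣⇒∣ᵤ n∣i-j
  ... | zero  | _     = ℤP.+-injective (ℤP.i-j≡0⇒i≡j (+ i) (+ j) (ℤP.∣i∣≡0⇒i≡0 eq))
  ... | suc k | n∣1+k = contradiction n∣1+k (ℕDiv.>⇒∤ (ℕP.≤-<-trans 1+k≤i⊔j (ℕP.⊔-lub i<n j<n)))
    where
    1+k≤i⊔j : suc k ℕ.≤ i ℕ.⊔ j
    1+k≤i⊔j = subst (ℕ._≤ i ℕ.⊔ j) (trans (cong ℤ.∣_∣ (sym (ℤP.m-n≡m⊖n i j))) eq) (ℤP.∣m⊝n∣≤m⊔n i j)

  %ℕ-≡⇒≈ : .{{_ : NonZero n}} → ∀ x y → x %ℕ n ≡ y %ℕ n → x ≈ y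
  %ℕ-≡⇒≈ x y eq = ≈-trans (≈-%ℕ x) (≈-trans (≈-reflexive (cong +_ eq)) (≈-sym (≈-%ℕ y)))

  ≈⇒%ℕ-≡ : .{{_ : NonZero n}} → ∀ {x y} → x ≈ y → x %ℕ n ≡ y %ℕ n
  ≈⇒%ℕ-≡ {x} {y} x≈y = ≈-below⇒≡ (ℤDivMod.n%ℕd<d x n) (ℤDivMod.n%ℕd<d y n)
    (≈-trans (≈-sym (≈-%ℕ x)) (≈-trans x≈y (≈-%ℕ y)))

module _ (r : ℕ) (c : Fin r → ℤ) (initial : ℕ → ℤ) where

  private
    nextTerm : ℕ → (ℕ → ℤ) → ℤ
    nextTerm n earlier with n ℕ.<? r
    ... | yes _ = initial n
    ... | no  _ = sumFin r (λ i → c i * earlier (toℕ i))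

    -- earlierTerms n i is the term at index n ∸ suc i, for i < n: the terms before n, most recent first.
    earlierTerms : ℕ → ℕ → ℤ
    earlierTerms zero    _       = + 0
    earlierTerms (suc n) zero    = nextTerm n (earlierTerms n)
    earlierTerms (suc n) (suc i) = earlierTerms n i

  fromInitial : ℕ → ℤ
  fromInitial n = nextTerm n (earlierTerms n)

  private
    earlierTerms-correct : ∀ n i → i < n → earlierTerms n i ≡ fromInitial (n ∸ suc i)
    earlierTerms-correct (suc n) zero    _         = refl
    earlierTerms-correct (suc n) (suc i) (s≤s i<n) = earlierTerms-correct n i i<n

  fromInitial-initial : ∀ {n} → n < r → fromInitial n ≡ initial n
  fromInitial-initial {n} n<r with n ℕ.<? r
  ... | yes _   = refl
  ... | no  n≮r = contradiction n<r n≮r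

  fromInitial-isLinRec : IsLinRec r c fromInitial
  fromInitial-isLinRec n r≤n with n ℕ.<? r
  ... | yes n<r = contradiction r≤n (ℕP.<⇒≱ n<r)
  ... | no  _   = sumFin-cong r (λ i →
    cong (c i *_) (earlierTerms-correct n (toℕ i) (ℕP.<-≤-trans (FinP.toℕ<n i) r≤n)))

module _ (M : ℕ) (r : ℕ) (c : Fin r → ℤ) where
  open Modulo M

  IsLinRecModulo : (ℕ → ℤ) → Set
  IsLinRecModulo s = ∀ n → r ≤ n → s n ≈ sumFin r (λ i → c i * s (n ∸ suc (toℕ i)))

  ≈-on-initial⇒≈ : ∀ {s t} → IsLinRec r c s → IsLinRecModulo t
    → (∀ n → n < r → s n ≈ t n) → ∀ n → s n ≈ t n
  ≈-on-initial⇒≈ {s} {t} s-rec t-rec initial≈ = <-rec (λ n → s n ≈ t n) step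
    where
    step : ∀ n → (∀ {k} → k < n → s k ≈ t k) → s n ≈ t n
    step n earlier≈ with n ℕ.<? r
    ... | yes n<r = initial≈ n n<r
    ... | no  n≮r = begin
      s n                                           ≡⟨ s-rec n r≤n ⟩
      sumFin r (λ i → c i * s (n ∸ suc (toℕ i)))   ≈⟨ sumFin-cong-≈ r (λ i → *-cong (≈-refl {c i}) (earlier≈ (index<n i))) ⟩
      sumFin r (λ i → c i * t (n ∸ suc (toℕ i)))   ≈⟨ t-rec n r≤n ⟨
      t n                                           ∎
      where
      open ≈-Reasoning setoid
      r≤n : r ≤ n
      r≤n = ℕP.≮⇒≥ n≮r
      index<n : ∀ i → n ∸ suc (toℕ i) < n
      index<n i = ℕP.∸-monoʳ-< (s≤s ℕ.z≤n) (ℕP.≤-trans (FinP.toℕ<n i) r≤n)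

  powers-shift : ∀ a j →
    a ^ j * eval (monic r c) a ≡ a ^ (j ℕ.+ r) - sumFin r (λ i → c i * a ^ (j ℕ.+ r ∸ suc (toℕ i)))
  powers-shift a j = begin
    a ^ j * eval (monic r c) a
      ≡⟨ cong (a ^ j *_) (eval-monic a r c) ⟩
    a ^ j * (a ^ r - sumFin r (λ i → c i * a ^ (r ∸ suc (toℕ i))))
      ≡⟨ *-distribˡ-minus (a ^ j) (a ^ r) _ ⟩
    a ^ j * a ^ r - a ^ j * sumFin r (λ i → c i * a ^ (r ∸ suc (toℕ i)))
      ≡⟨ cong₂ _-_ (sym (ℤP.^-distribˡ-+-* a j r)) (sumFin-distribˡ r (a ^ j) _) ⟩
    a ^ (j ℕ.+ r) - sumFin r (λ i → a ^ j * (c i * a ^ (r ∸ suc (toℕ i))))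
      ≡⟨ cong (λ t → a ^ (j ℕ.+ r) - t) (sumFin-cong r shift-term) ⟩
    a ^ (j ℕ.+ r) - sumFin r (λ i → c i * a ^ (j ℕ.+ r ∸ suc (toℕ i))) ∎
    where
    open ≡-Reasoning
    *-distribˡ-minus : ∀ t u v → t * (u - v) ≡ t * u - t * v
    *-distribˡ-minus = solve-∀
    swap : ∀ x y z → x * (y * z) ≡ y * (x * z)
    swap = solve-∀
    shift-term : ∀ i → a ^ j * (c i * a ^ (r ∸ suc (toℕ i))) ≡ c i * a ^ (j ℕ.+ r ∸ suc (toℕ i))
    shift-term i = begin
      a ^ j * (c i * a ^ (r ∸ suc (toℕ i)))  ≡⟨ swap (a ^ j) (c i) _ ⟩
      c i * (a ^ j * a ^ (r ∸ suc (toℕ i)))  ≡⟨ cong (c i *_) (ℤP.^-distribˡ-+-* a j _) ⟨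
      c i * a ^ (j ℕ.+ (r ∸ suc (toℕ i)))    ≡⟨ cong (λ e → c i * a ^ e) (ℕP.+-∸-assoc j (FinP.toℕ<n i)) ⟨
      c i * a ^ (j ℕ.+ r ∸ suc (toℕ i))      ∎

  powers-isLinRecModulo : ∀ a → + M ∣ˢ eval (monic r c) a → IsLinRecModulo (a ^_)
  powers-isLinRecModulo a M∣g[a] n r≤n =
    subst (λ k → a ^ k ≈ sumFin r (λ i → c i * a ^ (k ∸ suc (toℕ i)))) (ℕP.m∸n+n≡m r≤n)
      (∣⇒≈ (powers-shift a (n ∸ r)) (Signed.∣n⇒∣m*n (a ^ (n ∸ r)) M∣g[a]))

module _ {p : ℕ} (p-prime : Prime p) where

  prime∣*⇒∣⊎∣ : ∀ i j → + p ∣ i * j → + p ∣ i ⊎ + p ∣ j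
  prime∣*⇒∣⊎∣ i j p∣ij = euclidsLemma ℤ.∣ i ∣ ℤ.∣ j ∣ p-prime (subst (p ℕDiv.∣_) (ℤP.abs-* i j) p∣ij)

  prime∤⇒∤^ : ∀ {a} → ¬ + p ∣ a → ∀ k → ¬ + p ∣ a ^ k
  prime∤⇒∤^ p∤a zero    p∣1       = ¬prime[1] (subst Prime (ℕDiv.∣1⇒≡1 p∣1) p-prime)
  prime∤⇒∤^ {a} p∤a (suc k) p∣a^1+k = [ p∤a , prime∤⇒∤^ p∤a k ]′ (prime∣*⇒∣⊎∣ a (a ^ k) p∣a^1+k)

  module _ {a : ℤ} {m : ℕ} (p∤a : ¬ + p ∣ a) (order : MultOrder a p m) where
    open Modulo p

    instance
      _ : NonZero p
      _ = prime⇒nonZero p-prime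
      _ : NonZero m
      _ = ℕ.>-nonZero (proj₁ order)

    a^m≈1 : a ^ m ≈ + 1
    a^m≈1 = mod∣ (Signed.∣ᵤ⇒∣ (proj₁ (proj₂ order)))

    ^-≉-below-order : ∀ {i j} → i < j → j < m → ¬ a ^ i ≈ a ^ j
    ^-≉-below-order {i} {j} i<j j<m a^i≈a^j =
      [ prime∤⇒∤^ p∤a i , (λ p∣a^d-1 → ℕP.<⇒≱ d<m (proj₂ (proj₂ order) d (ℕP.m<n⇒0<n∸m i<j) p∣a^d-1)) ]′
        (prime∣*⇒∣⊎∣ (a ^ i) (a ^ d - + 1) (Signed.∣⇒∣ᵤ (subst (+ p ∣ˢ_) factor (∣-diff (≈-sym a^i≈a^j)))))
      where
      open ≡-Reasoning
      d : ℕ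
      d = j ∸ i
      d<m : d < m
      d<m = ℕP.≤-<-trans (ℕP.m∸n≤m j i) j<m
      factor : a ^ j - a ^ i ≡ a ^ i * (a ^ d - + 1)
      factor = begin
        a ^ j - a ^ i           ≡⟨ cong (λ e → a ^ e - a ^ i) (ℕP.m+[n∸m]≡n (ℕP.<⇒≤ i<j)) ⟨
        a ^ (i ℕ.+ d) - a ^ i   ≡⟨ cong (_- a ^ i) (ℤP.^-distribˡ-+-* a i d) ⟩
        a ^ i * a ^ d - a ^ i   ≡⟨ factor-out (a ^ i) (a ^ d) ⟩
        a ^ i * (a ^ d - + 1)   ∎
        where
        factor-out : ∀ x y → x * y - x ≡ x * (y - + 1)
        factor-out = solve-∀

    ^-≈-^-% : ∀ k → a ^ k ≈ a ^ (k ℕ.% m)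
    ^-≈-^-% k = begin
      a ^ k                                  ≡⟨ cong (a ^_) (ℕDivMod.m≡m%n+[m/n]*n k m) ⟩
      a ^ (k ℕ.% m ℕ.+ k ℕ./ m ℕ.* m)        ≡⟨ ℤP.^-distribˡ-+-* a (k ℕ.% m) _ ⟩
      a ^ (k ℕ.% m) * a ^ (k ℕ./ m ℕ.* m)    ≡⟨ cong (λ e → a ^ (k ℕ.% m) * a ^ e) (ℕP.*-comm (k ℕ./ m) m) ⟩
      a ^ (k ℕ.% m) * a ^ (m ℕ.* (k ℕ./ m))  ≡⟨ cong (a ^ (k ℕ.% m) *_) (ℤP.^-*-assoc a m (k ℕ./ m)) ⟨
      a ^ (k ℕ.% m) * (a ^ m) ^ (k ℕ./ m)    ≈⟨ *-cong (≈-refl {a ^ (k ℕ.% m)}) (^-cong (k ℕ./ m) a^m≈1) ⟩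
      a ^ (k ℕ.% m) * (+ 1) ^ (k ℕ./ m)      ≡⟨ cong (a ^ (k ℕ.% m) *_) (ℤP.^-zeroˡ (k ℕ./ m)) ⟩
      a ^ (k ℕ.% m) * + 1                    ≡⟨ ℤP.*-identityʳ (a ^ (k ℕ.% m)) ⟩
      a ^ (k ℕ.% m)                          ∎
      where open ≈-Reasoning setoid

    powers-takesExactlyResidues : TakesExactlyResidues (a ^_) p m
    powers-takesExactlyResidues = residue , residue-injective , (λ j → toℕ j , refl) , covered
      where
      residue : Fin m → ℕ
      residue j = a ^ toℕ j %ℕ p
      residue-injective : ∀ {i j} → residue i ≡ residue j → i ≡ j
      residue-injective {i} {j} eq with ℕP.<-cmp (toℕ i) (toℕ j)
      ... | tri< i<j _ _ = contradiction (%ℕ-≡⇒≈ _ _ eq) (^-≉-below-order i<j (FinP.toℕ<n j))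
      ... | tri≈ _ i≡j _ = FinP.toℕ-injective i≡j
      ... | tri> _ _ j<i = contradiction (%ℕ-≡⇒≈ _ _ (sym eq)) (^-≉-below-order j<i (FinP.toℕ<n i))
      covered : ∀ k → ∃ λ j → residue j ≡ a ^ k %ℕ p
      covered k = Fin.fromℕ< (ℕDivMod.m%n<n k m) ,
        trans (cong (λ e → a ^ e %ℕ p) (FinP.toℕ-fromℕ< (ℕDivMod.m%n<n k m))) (≈⇒%ℕ-≡ (≈-sym (^-≈-^-% k)))

TakesExactlyResidues-cong : ∀ {s t M m} .{{_ : NonZero M}} → (∀ n → s n %ℕ M ≡ t n %ℕ M)
  → TakesExactlyResidues s M m → TakesExactlyResidues t M m
TakesExactlyResidues-cong s≗t (v , v-injective , hit , covered) =
  v , v-injective , (λ j → Product.map₂ (λ eq → trans eq (s≗t _)) (hit j))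
                  , (λ n → Product.map₂ (λ eq → trans eq (s≗t n)) (covered n))

lemma1p1 : (d r : ℕ) → 0 < d → 0 < r → (cf : Fin d → ℤ) → (cg : Fin r → ℤ)
    → monic d cf ∣ₚ monic r cg → (m : ℕ) → 0 < m → (p : ℕ) → Prime p
    → Σ ℤ (λ a → ¬ (+ p ∣ a) × (+ p ∣ eval (monic d cf) a) × MultOrder a p m)
    → InM r cg m
lemma1p1 d r _ _ cf cg f∣g m _ p p-prime (a , p∤a , p∣f[a] , order) =
  s , s-isLinRec , p , p≢0 ,
  TakesExactlyResidues-cong {a ^_} {s} (λ n → ≈⇒%ℕ-≡ (≈-sym (s≈a^ n)))
    (powers-takesExactlyResidues p-prime p∤a order)
  where
  open Modulo p
  instance
    p≢0 : NonZero p
    p≢0 = prime⇒nonZero p-prime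
  s : ℕ → ℤ
  s = fromInitial r cg (a ^_)
  s-isLinRec : IsLinRec r cg s
  s-isLinRec = fromInitial-isLinRec r cg (a ^_)
  p∣g[a] : + p ∣ˢ eval (monic r cg) a
  p∣g[a] = Signed.∣-trans (Signed.∣ᵤ⇒∣ p∣f[a]) (eval-∣ₚ a {monic d cf} {monic r cg} f∣g)
  s≈a^ : ∀ n → s n ≈ a ^ n
  s≈a^ = ≈-on-initial⇒≈ p r cg s-isLinRec (powers-isLinRecModulo p r cg a p∣g[a])
    (λ n n<r → ≈-reflexive (fromInitial-initial r cg (a ^_) n<r))
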